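{- Let $m$ be a positive integer and let $\beta \in S_{2m-1}$ be a permutation with exactly $m-1$ fixed points. Then $c(2m-1, \beta)=(m!)^2$.
   Context: $S_n$ is the group of permutations of $[n]=\{1,\dots,n\}$; products are composed right to left. The Hamming distance between $\sigma,\tau\in S_n$ is $H(\sigma,\tau)=|\{a\in[n]:\sigma(a)\neq\tau(a)\}|$. Two permutations $\alpha,\beta\in S_n$ $k$-commute if $H(\alpha\beta,\beta\alpha)=k$. For $\beta\in S_n$ and a nonnegative integer $k$, $c(k,\beta)$ denotes the number of $\alpha\in S_n$ that $k$-commute with $\beta$. -}

module Defs where

open import Data.Nat using (ℕ; zero; suc; _≟_)
open import Data.Fin using (Fin; _≟_)
open import Data.Fin.Properties using (all?)
open import Data.Fin.Permutation using (Permutation′; _⟨$⟩ʳ_)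
open import Data.List using (List; []; _∷_; [_]; map; concatMap; filter; length; allFin)
open import Data.Vec using (Vec; lookup) renaming ([] to []ᵥ; _∷_ to _∷ᵥ_)
open import Function using (_∘_)
open import Relation.Binary.PropositionalEquality using (_≡_)
open import Relation.Nullary using (¬?)
open import Relation.Nullary.Decidable using (_→-dec_)

allVecs : (n k : ℕ) → List (Vec (Fin n) k)
allVecs n zero    = [ []ᵥ ]
allVecs n (suc k) = concatMap (λ i → map (i ∷ᵥ_) (allVecs n k)) (allFin n)

-- All maps Fin n → Fin n (each exactly once, up to extensional equality).
allMaps : (n : ℕ) → List (Fin n → Fin n)
allMaps n = map lookup (allVecs n n)

-- The symmetric group S_n, enumerated: the injective (= bijective) maps [n] → [n],
-- each permutation listed exactly once.
Sym : (n : ℕ) → List (Fin n → Fin n)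
Sym n = filter (λ f → all? (λ a → all? (λ b → (f a Data.Fin.≟ f b) →-dec (a Data.Fin.≟ b)))) (allMaps n)

hamming : {n : ℕ} → (Fin n → Fin n) → (Fin n → Fin n) → ℕ
hamming {n} σ τ = length (filter (λ a → ¬? (σ a Data.Fin.≟ τ a)) (allFin n))

fixedPoints : {n : ℕ} → Permutation′ n → ℕ
fixedPoints {n} β = length (filter (λ a → (β ⟨$⟩ʳ a) Data.Fin.≟ a) (allFin n))

-- c(k,β) = |{α ∈ S_n : H(αβ, βα) = k}|  (composition right to left).
c : {n : ℕ} → ℕ → Permutation′ n → ℕ
c {n} k β = length (filter (λ α → hamming (α ∘ (β ⟨$⟩ʳ_)) ((β ⟨$⟩ʳ_) ∘ α) Data.Nat.≟ k) (Sym n))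

-- Write Fix and Mov for the fixed and the moved points of β ∈ S_n.  An α
-- n-commutes with β iff αβ(a) ≠ βα(a) for every a, i.e. α commutes with β
-- at no point.  At a fixed point a this says βα(a) ≠ α(a), i.e. α(a) ∈ Mov;
-- so every such α maps Fix into Mov.  Conversely, if |Mov| ≤ |Fix| + 1 and α
-- is injective with α(Fix) ⊆ Mov, then α commutes with β nowhere: were
-- αβ(a) = βα(a) at a moved point a, both α(a) and α(βa) would be moved, and
-- α would map the |Fix| + 2 points Fix ∪ {a, βa} injectively into Mov.
-- Hence c(n, β) counts the permutations with α(Fix) ⊆ Mov, and a general
-- count of injections whose marked positions land in a given target set gives
-- c(n, β) = |Mov|↓|Fix| · (n − |Fix|)↓|Mov| = |Mov|↓|Fix| · |Mov|!
-- (falling factorials), which is m! · m! when n = 2m − 1 and |Fix| = m − 1.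
module Submission where

open import Defs
open import Data.Nat using (ℕ; _*_; _∸_; _^_; _≤_; _!)
open import Data.Fin.Permutation using (Permutation′)
open import Relation.Binary.PropositionalEquality using (_≡_)

open import Data.Nat using (zero; suc; _+_; pred; _<_; s≤s; z≤n; _≟_; _≤?_)
open import Data.Nat.Properties
  using ( +-identityʳ; +-suc; +-cancelˡ-≡; *-identityʳ; *-zeroʳ; *-comm; *-assoc; *-distribˡ-+
        ; ≤-reflexive; ≤-trans; <-irrefl; m≤n⇒m≤1+n; m<n⇒m<1+n; ≰⇒>
        ; 0∸n≡0; +-∸-comm; m+n∸m≡n; pred[m∸n]≡m∸[1+n] )
open import Data.Nat.Tactic.RingSolver using (solve-∀)
open import Data.Fin as F using (Fin; zero; suc)
open import Data.Fin.Properties using (all?) renaming (0≢1+n to zero≢suc; suc-injective to fsuc-injective)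
open import Data.Fin.Permutation using (_⟨$⟩ʳ_; _⟨$⟩ˡ_; inverseˡ)
open import Data.Bool using (Bool; true; false; not; _∧_; _∨_; if_then_else_)
open import Data.Bool.Properties using (∧-identityʳ; ∧-zeroʳ)
open import Data.List using (List; []; _∷_; map; concatMap; filter; length; allFin; tabulate; _++_)
open import Data.Vec using (Vec; lookup) renaming ([] to []ᵥ; _∷_ to _∷ᵥ_)
open import Data.Product using (_×_; _,_; proj₁; proj₂)
open import Data.Sum using (_⊎_; inj₁; inj₂)
open import Data.Empty using (⊥-elim)
open import Function using (_∘_; id)
open import Relation.Binary.PropositionalEquality using (refl; sym; trans; cong; cong₂; subst; _≢_; module ≡-Reasoning)
open import Relation.Nullary using (Dec; yes; no; does; ¬?)
open import Relation.Nullary.Decidable using (_→-dec_; dec-true; dec-false)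
open import Relation.Unary using (Pred; Decidable)
open import Level using (0ℓ)

does-true : ∀ {P : Set} (d : Dec P) → does d ≡ true → P
does-true (yes p) _ = p

eqF : ∀ {n} → Fin n → Fin n → Bool
eqF x y = does (x F.≟ y)

∧-true : ∀ {a b} → a ∧ b ≡ true → a ≡ true × b ≡ true
∧-true {true} {true} _ = refl , refl

∨-true : ∀ {a b} → a ∨ b ≡ true → a ≡ true ⊎ b ≡ true
∨-true {true} _ = inj₁ refl
∨-true {false} e = inj₂ e

∨-false : ∀ {a b} → a ∨ b ≡ false → a ≡ false × b ≡ false
∨-false {false} {false} _ = refl , refl

not-true : ∀ {a} → not a ≡ true → a ≡ false
not-true {false} _ = refl

bool-ext : ∀ {a b : Bool} → (a ≡ true → b ≡ true) → (b ≡ true → a ≡ true) → a ≡ b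
bool-ext {true} {true} _ _ = refl
bool-ext {true} {false} f _ with () ← f refl
bool-ext {false} {true} _ g with () ← g refl
bool-ext {false} {false} _ _ = refl

addB : Bool → ℕ → ℕ
addB true k = suc k
addB false k = k

cnt : ∀ {A : Set} → (A → Bool) → List A → ℕ
cnt f [] = 0
cnt f (x ∷ xs) = addB (f x) (cnt f xs)

module _ {A : Set} where

  length-filter : ∀ {P : Pred A 0ℓ} (P? : Decidable P) xs →
                  length (filter P? xs) ≡ cnt (λ x → does (P? x)) xs
  length-filter P? [] = refl
  length-filter P? (x ∷ xs) with does (P? x)
  ... | true = cong suc (length-filter P? xs)
  ... | false = length-filter P? xs

  cnt-filter : ∀ {P : Pred A 0ℓ} (P? : Decidable P) (g : A → Bool) xs →
               cnt g (filter P? xs) ≡ cnt (λ x → does (P? x) ∧ g x) xs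
  cnt-filter P? g [] = refl
  cnt-filter P? g (x ∷ xs) with does (P? x)
  ... | true = cong (addB (g x)) (cnt-filter P? g xs)
  ... | false = cnt-filter P? g xs

  cnt-map : ∀ {B : Set} (g : B → Bool) (h : A → B) xs → cnt g (map h xs) ≡ cnt (g ∘ h) xs
  cnt-map g h [] = refl
  cnt-map g h (x ∷ xs) = cong (addB (g (h x))) (cnt-map g h xs)

  cnt-++ : ∀ (g : A → Bool) xs ys → cnt g (xs ++ ys) ≡ cnt g xs + cnt g ys
  cnt-++ g [] ys = refl
  cnt-++ g (x ∷ xs) ys with g x
  ... | true = cong suc (cnt-++ g xs ys)
  ... | false = cnt-++ g xs ys

  cnt-cong : ∀ {f g : A → Bool} → (∀ x → f x ≡ g x) → ∀ xs → cnt f xs ≡ cnt g xs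
  cnt-cong e [] = refl
  cnt-cong e (x ∷ xs) = cong₂ addB (e x) (cnt-cong e xs)

  cnt-guard : ∀ (b : Bool) (f : A → Bool) xs → cnt (λ x → b ∧ f x) xs ≡ (if b then cnt f xs else 0)
  cnt-guard true f xs = refl
  cnt-guard false f [] = refl
  cnt-guard false f (x ∷ xs) = cnt-guard false f xs

cntF : ∀ {n} → (Fin n → Bool) → ℕ
cntF {zero} h = 0
cntF {suc n} h = addB (h zero) (cntF (h ∘ suc))

sumF : ∀ {n} → (Fin n → ℕ) → ℕ
sumF {zero} f = 0
sumF {suc n} f = f zero + sumF (f ∘ suc)

cnt-tabulate : ∀ {A : Set} {n} (f : A → Bool) (h : Fin n → A) → cnt f (tabulate h) ≡ cntF (f ∘ h)
cnt-tabulate {n = zero} f h = refl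
cnt-tabulate {n = suc n} f h = cong (addB (f (h zero))) (cnt-tabulate f (h ∘ suc))

cnt-concatMap : ∀ {A B : Set} {n} (f : B → Bool) (g : A → List B) (h : Fin n → A) →
                cnt f (concatMap g (tabulate h)) ≡ sumF (λ i → cnt f (g (h i)))
cnt-concatMap {n = zero} f g h = refl
cnt-concatMap {n = suc n} f g h =
  trans (cnt-++ f (g (h zero)) _) (cong (cnt f (g (h zero)) +_) (cnt-concatMap f g (h ∘ suc)))

cntF-cong : ∀ {n} {f g : Fin n → Bool} → (∀ x → f x ≡ g x) → cntF f ≡ cntF g
cntF-cong {zero} e = refl
cntF-cong {suc n} e = cong₂ addB (e zero) (cntF-cong (e ∘ suc))

sumF-cong : ∀ {n} {f g : Fin n → ℕ} → (∀ x → f x ≡ g x) → sumF f ≡ sumF g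
sumF-cong {zero} e = refl
sumF-cong {suc n} e = cong₂ _+_ (e zero) (sumF-cong (e ∘ suc))

sumF-+ : ∀ {n} (f g : Fin n → ℕ) → sumF (λ i → f i + g i) ≡ sumF f + sumF g
sumF-+ {zero} f g = refl
sumF-+ {suc n} f g =
  trans (cong ((f zero + g zero) +_) (sumF-+ (f ∘ suc) (g ∘ suc)))
        (interchange (f zero) (g zero) (sumF (f ∘ suc)) (sumF (g ∘ suc)))
  where
  interchange : ∀ a b c d → (a + b) + (c + d) ≡ (a + c) + (b + d)
  interchange = solve-∀

sumF-marked : ∀ {n} (b : Fin n → Bool) (f : Fin n → ℕ) K → (∀ i → b i ≡ true → f i ≡ K) →
              sumF (λ i → if b i then f i else 0) ≡ cntF b * K
sumF-marked {zero} b f K e = refl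
sumF-marked {suc n} b f K e with b zero in eb
... | true = cong₂ _+_ (e zero eb) (sumF-marked (b ∘ suc) (f ∘ suc) K (e ∘ suc))
... | false = sumF-marked (b ∘ suc) (f ∘ suc) K (e ∘ suc)

sumF-partition : ∀ {n} (c g : Fin n → Bool) (f : Fin n → ℕ) →
                 sumF (λ i → if c i then f i else 0)
                   ≡ sumF (λ i → if c i ∧ g i then f i else 0) + sumF (λ i → if c i ∧ not (g i) then f i else 0)
sumF-partition c g f =
  trans (sumF-cong pointwise)
        (sumF-+ (λ i → if c i ∧ g i then f i else 0) (λ i → if c i ∧ not (g i) then f i else 0))
  where
  pointwise : ∀ i → (if c i then f i else 0)
                    ≡ (if c i ∧ g i then f i else 0) + (if c i ∧ not (g i) then f i else 0)
  pointwise i with c i | g i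
  ... | true | true = sym (+-identityʳ (f i))
  ... | true | false = refl
  ... | false | _ = refl

cntF-split : ∀ {n} (h g : Fin n → Bool) → cntF h ≡ cntF (λ x → h x ∧ g x) + cntF (λ x → h x ∧ not (g x))
cntF-split {zero} h g = refl
cntF-split {suc n} h g with h zero | g zero | cntF-split (h ∘ suc) (g ∘ suc)
... | true | true | e = cong suc e
... | true | false | e = trans (cong suc e) (sym (+-suc _ _))
... | false | _ | e = e

cntF-compl : ∀ {n} (h : Fin n → Bool) → cntF h + cntF (not ∘ h) ≡ n
cntF-compl {zero} h = refl
cntF-compl {suc n} h with h zero | cntF-compl (h ∘ suc)
... | true | e = cong suc e
... | false | e = trans (+-suc _ _) (cong suc e)

cntF-mono : ∀ {n} {h g : Fin n → Bool} → (∀ x → h x ≡ true → g x ≡ true) → cntF h ≤ cntF g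
cntF-mono {zero} e = z≤n
cntF-mono {suc n} {h} {g} e with h zero in eh | g zero in eg | cntF-mono {h = h ∘ suc} {g ∘ suc} (e ∘ suc)
... | true | true | r = s≤s r
... | true | false | r with () ← trans (sym (e zero eh)) eg
... | false | true | r = m≤n⇒m≤1+n r
... | false | false | r = r

cntF-le : ∀ {n} (h : Fin n → Bool) → cntF h ≤ n
cntF-le {zero} h = z≤n
cntF-le {suc n} h with h zero
... | true = s≤s (cntF-le (h ∘ suc))
... | false = m≤n⇒m≤1+n (cntF-le (h ∘ suc))

cntF-all : ∀ {n} (h : Fin n → Bool) → cntF h ≡ n → ∀ x → h x ≡ true
cntF-all {suc n} h e x with h zero in eh | cntF-le (h ∘ suc)
cntF-all {suc n} h e zero | true | _ = eh
cntF-all {suc n} h e (suc x) | true | _ = cntF-all (h ∘ suc) (cong pred e) x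
... | false | le = ⊥-elim (<-irrefl refl (subst (_≤ n) e le))

cntF-true : ∀ {n} (h : Fin n → Bool) → (∀ x → h x ≡ true) → cntF h ≡ n
cntF-true {zero} h e = refl
cntF-true {suc n} h e = trans (cong (λ z → addB z (cntF (h ∘ suc))) (e zero)) (cong suc (cntF-true (h ∘ suc) (e ∘ suc)))

cntF-point : ∀ {n} (h : Fin n → Bool) (i : Fin n) → cntF h ≡ addB (h i) (cntF (λ x → h x ∧ not (eqF x i)))
cntF-point {suc n} h zero = cong (addB (h zero)) (trans (cntF-cong (λ x → sym (∧-identityʳ (h (suc x))))) (absorb (h zero)))
  where
  absorb : ∀ b → cntF (λ x → h (suc x) ∧ true) ≡ addB (b ∧ false) (cntF (λ x → h (suc x) ∧ true))
  absorb true = refl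
  absorb false = refl
cntF-point {suc n} h (suc j) =
  trans (cong (addB (h zero)) (cntF-point (h ∘ suc) j))
        (trans (swap (h zero) (h (suc j)) _) (cong (addB (h (suc j))) (cong₂ addB (sym (∧-identityʳ (h zero))) refl)))
  where
  swap : ∀ a b k → addB a (addB b k) ≡ addB b (addB a k)
  swap true true k = refl
  swap true false k = refl
  swap false true k = refl
  swap false false k = refl

cntF-insert : ∀ {n} (h : Fin n → Bool) i → h i ≡ false → cntF (λ x → h x ∨ eqF x i) ≡ suc (cntF h)
cntF-insert h i hi = begin
    cntF (λ x → h x ∨ eqF x i)
  ≡⟨ cntF-point (λ x → h x ∨ eqF x i) i ⟩
    addB (h i ∨ eqF i i) (cntF (λ x → (h x ∨ eqF x i) ∧ not (eqF x i)))
  ≡⟨ cong₂ addB (cong₂ _∨_ hi (dec-true (i F.≟ i) refl)) (cntF-cong (λ x → drop (h x) (eqF x i))) ⟩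
    suc (cntF (λ x → h x ∧ not (eqF x i)))
  ≡⟨ cong suc (sym (trans (cntF-point h i) (cong (λ b → addB b (cntF (λ x → h x ∧ not (eqF x i)))) hi))) ⟩
    suc (cntF h) ∎
  where
  open ≡-Reasoning
  drop : ∀ p q → (p ∨ q) ∧ not q ≡ p ∧ not q
  drop true true = refl
  drop true false = refl
  drop false true = refl
  drop false false = refl

Injective : ∀ {k n} → (Fin k → Fin n) → Set
Injective f = ∀ a b → f a ≡ f b → a ≡ b

cntF-injective : ∀ {k n} (f : Fin k → Fin n) → Injective f → (T : Fin n → Bool) → cntF (T ∘ f) ≤ cntF T
cntF-injective {zero} f inj T = z≤n
cntF-injective {suc k} f inj T =
  subst (addB (T (f zero)) (cntF (T ∘ f ∘ suc)) ≤_) (sym (cntF-point T (f zero)))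
        (addB-mono (T (f zero)) (subst (_≤ cntF T′) (sym (cntF-cong avoids))
          (cntF-injective (f ∘ suc) (λ a b q → fsuc-injective (inj (suc a) (suc b) q)) T′)))
  where
  T′ : Fin _ → Bool
  T′ y = T y ∧ not (eqF y (f zero))
  avoids : ∀ x → T (f (suc x)) ≡ T′ (f (suc x))
  avoids x rewrite dec-false (f (suc x) F.≟ f zero) (λ q → zero≢suc (sym (inj _ _ q))) = sym (∧-identityʳ _)
  addB-mono : ∀ b {x y} → x ≤ y → addB b x ≤ addB b y
  addB-mono true le = s≤s le
  addB-mono false le = le

-- a ↓ p = a (a-1) ⋯ (a-p+1), the number of injections of a p-set into an a-set.
infix 8 _↓_
_↓_ : ℕ → ℕ → ℕ
a ↓ zero = 1
a ↓ suc p = a * (pred a ↓ p)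

pred-∸ : ∀ a p → pred a ∸ p ≡ a ∸ suc p
pred-∸ zero p = 0∸n≡0 p
pred-∸ (suc a) p = refl

↓-suc : ∀ a p → a ↓ suc p ≡ a ↓ p * (a ∸ p)
↓-suc a zero = trans (*-identityʳ a) (sym (+-identityʳ a))
↓-suc a (suc p) = begin
    a * (pred a ↓ suc p)              ≡⟨ cong (a *_) (↓-suc (pred a) p) ⟩
    a * (pred a ↓ p * (pred a ∸ p))   ≡⟨ sym (*-assoc a _ _) ⟩
    a * (pred a ↓ p) * (pred a ∸ p)   ≡⟨ cong (a * (pred a ↓ p) *_) (pred-∸ a p) ⟩
    a * (pred a ↓ p) * (a ∸ suc p)    ∎
  where open ≡-Reasoning

↓-vanish : ∀ a p → a < p → a ↓ p ≡ 0
↓-vanish zero (suc p) _ = refl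
↓-vanish (suc a) (suc p) (s≤s lt) = trans (cong (suc a *_) (↓-vanish a p lt)) (*-zeroʳ (suc a))

↓-self : ∀ a → a ↓ a ≡ a !
↓-self zero = refl
↓-self (suc a) = cong (suc a *_) (↓-self a)

↓-pred-self : ∀ a → suc a ↓ a ≡ suc a !
↓-pred-self zero = refl
↓-pred-self (suc a) = cong (suc (suc a) *_) (↓-pred-self a)

-- Choosing p images among A + B points with the first drawn from the A
-- "good" ones or from the B "bad" ones: A (A-1)↓p + B (A↓p) = A↓p · (A+B-p).
↓-split : ∀ A B p → A * (pred A ↓ p) + B * (A ↓ p) ≡ A ↓ p * (A + B ∸ p)
↓-split A B p with p ≤? A
... | yes p≤A = begin
    A ↓ suc p + B * (A ↓ p)        ≡⟨ cong (_+ B * (A ↓ p)) (↓-suc A p) ⟩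
    A ↓ p * (A ∸ p) + B * (A ↓ p)  ≡⟨ cong (A ↓ p * (A ∸ p) +_) (*-comm B (A ↓ p)) ⟩
    A ↓ p * (A ∸ p) + A ↓ p * B    ≡⟨ sym (*-distribˡ-+ (A ↓ p) (A ∸ p) B) ⟩
    A ↓ p * (A ∸ p + B)            ≡⟨ cong (A ↓ p *_) (sym (+-∸-comm B p≤A)) ⟩
    A ↓ p * (A + B ∸ p)            ∎
  where open ≡-Reasoning
... | no p≰A = begin
    A ↓ suc p + B * (A ↓ p)  ≡⟨ cong₂ (λ x y → x + B * y) (↓-vanish A (suc p) (m<n⇒m<1+n A<p)) (↓-vanish A p A<p) ⟩
    B * 0                    ≡⟨ *-zeroʳ B ⟩
    0                        ≡⟨ sym (cong (_* (A + B ∸ p)) (↓-vanish A p A<p)) ⟩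
    A ↓ p * (A + B ∸ p)      ∎
  where
  open ≡-Reasoning
  A<p : A < p
  A<p = ≰⇒> p≰A

-- Fix a set `good` of targets.  Given a marking t of the k positions of a
-- vector and a set U of targets already used, `admissible t U v` says that the
-- entries of v are pairwise distinct, avoid U, and are good at marked
-- positions.  The number of such v is freeGood U ↓ |t| · (free U − |t|) ↓ |¬t|:
-- marked positions choose among the unused good targets, the remaining ones
-- among whatever is left.
module ConstrainedInjections {n : ℕ} (good : Fin n → Bool) where

  insert : (Fin n → Bool) → Fin n → Fin n → Bool
  insert U i x = U x ∨ eqF x i

  allowed : Bool → Fin n → Bool
  allowed b i = not b ∨ good i

  admissible : ∀ {k} → (Fin k → Bool) → (Fin n → Bool) → Vec (Fin n) k → Bool
  admissible t U []ᵥ = true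
  admissible t U (i ∷ᵥ v) = (not (U i) ∧ allowed (t zero) i) ∧ admissible (t ∘ suc) (insert U i) v

  freeIn : (Fin n → Bool) → (Fin n → Bool) → ℕ
  freeIn g U = cntF (λ x → not (U x) ∧ g x)

  free freeGood freeBad : (Fin n → Bool) → ℕ
  free = freeIn (λ _ → true)
  freeGood = freeIn good
  freeBad = freeIn (not ∘ good)

  free-split : ∀ U → free U ≡ freeGood U + freeBad U
  free-split U = trans (cntF-cong (λ x → ∧-identityʳ (not (U x)))) (cntF-split (not ∘ U) good)

  freeIn-insert : ∀ g U i → U i ≡ false → freeIn g U ≡ addB (g i) (freeIn g (insert U i))
  freeIn-insert g U i Ui = trans (cntF-point (λ x → not (U x) ∧ g x) i)
    (cong₂ addB (cong (λ u → not u ∧ g i) Ui) (cntF-cong (λ x → removed (U x) (eqF x i) (g x))))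
    where
    removed : ∀ u e b → (not u ∧ b) ∧ not e ≡ not (u ∨ e) ∧ b
    removed true e b = refl
    removed false true b = ∧-zeroʳ b
    removed false false b = ∧-identityʳ b

  free-insert : ∀ U i → U i ≡ false → free (insert U i) ≡ pred (free U)
  free-insert U i Ui = cong pred (sym (freeIn-insert (λ _ → true) U i Ui))

  freeGood-insert : ∀ U i → U i ≡ false → freeGood (insert U i) ≡ (if good i then pred (freeGood U) else freeGood U)
  freeGood-insert U i Ui with good i | freeIn-insert good U i Ui
  ... | true | e = cong pred (sym e)
  ... | false | e = sym e

  -- The number of admissible completions with p marked and q unmarked positions left.
  completions : ℕ → ℕ → (Fin n → Bool) → ℕ
  completions p q U = freeGood U ↓ p * (free U ∸ p) ↓ q

  completions-insert-good : ∀ p q U i → U i ≡ false → good i ≡ true →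
                            completions p q (insert U i) ≡ pred (freeGood U) ↓ p * (pred (free U) ∸ p) ↓ q
  completions-insert-good p q U i Ui gi = cong₂ (λ a r → a ↓ p * (r ∸ p) ↓ q)
    (trans (freeGood-insert U i Ui) (cong (λ b → if b then pred (freeGood U) else freeGood U) gi)) (free-insert U i Ui)

  completions-insert-bad : ∀ p q U i → U i ≡ false → good i ≡ false →
                           completions p q (insert U i) ≡ freeGood U ↓ p * (pred (free U) ∸ p) ↓ q
  completions-insert-bad p q U i Ui bi = cong₂ (λ a r → a ↓ p * (r ∸ p) ↓ q)
    (trans (freeGood-insert U i Ui) (cong (λ b → if b then pred (freeGood U) else freeGood U) bi)) (free-insert U i Ui)

  sum-free : ∀ g U (f : Fin n → ℕ) K → (∀ i → U i ≡ false → g i ≡ true → f i ≡ K) →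
             sumF (λ i → if not (U i) ∧ g i then f i else 0) ≡ freeIn g U * K
  sum-free g U f K e = sumF-marked (λ i → not (U i) ∧ g i) f K
    (λ i c → e i (not-true (proj₁ (∧-true c))) (proj₂ (∧-true c)))

  -- The first position is marked: it takes one of the unused good targets.
  place-marked : ∀ p q U → sumF (λ i → if not (U i) ∧ allowed true i then completions p q (insert U i) else 0)
                           ≡ completions (suc p) q U
  place-marked p q U = begin
      sumF (λ i → if not (U i) ∧ good i then completions p q (insert U i) else 0)
    ≡⟨ sum-free good U _ K (completions-insert-good p q U) ⟩
      A * (pred A ↓ p * (pred R ∸ p) ↓ q)
    ≡⟨ sym (*-assoc A (pred A ↓ p) _) ⟩
      A ↓ suc p * (pred R ∸ p) ↓ q
    ≡⟨ cong (λ r → A ↓ suc p * r ↓ q) (pred-∸ R p) ⟩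
      completions (suc p) q U ∎
    where
    open ≡-Reasoning
    A = freeGood U
    R = free U
    K = pred A ↓ p * (pred R ∸ p) ↓ q

  -- The first position is unmarked: it takes any unused target, good or bad.
  place-unmarked : ∀ p q U → sumF (λ i → if not (U i) ∧ allowed false i then completions p q (insert U i) else 0)
                             ≡ completions p (suc q) U
  place-unmarked p q U = begin
      sumF (λ i → if not (U i) ∧ true then F i else 0)
    ≡⟨ sumF-cong (λ i → cong (λ b → if b then F i else 0) (∧-identityʳ (not (U i)))) ⟩
      sumF (λ i → if not (U i) then F i else 0)
    ≡⟨ sumF-partition (not ∘ U) good F ⟩
      sumF (λ i → if not (U i) ∧ good i then F i else 0) + sumF (λ i → if not (U i) ∧ not (good i) then F i else 0)
    ≡⟨ cong₂ _+_ (sum-free good U F (pred A ↓ p * D) (completions-insert-good p q U))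
                   (sum-free (not ∘ good) U F (A ↓ p * D) (λ i Ui bi → completions-insert-bad p q U i Ui (not-true bi))) ⟩
      A * (pred A ↓ p * D) + B * (A ↓ p * D)
    ≡⟨ regroup A (pred A ↓ p) B (A ↓ p) D ⟩
      (A * (pred A ↓ p) + B * (A ↓ p)) * D
    ≡⟨ cong (_* D) (↓-split A B p) ⟩
      A ↓ p * (A + B ∸ p) * D
    ≡⟨ cong (λ r → A ↓ p * (r ∸ p) * D) (sym (free-split U)) ⟩
      A ↓ p * (R ∸ p) * D
    ≡⟨ *-assoc (A ↓ p) (R ∸ p) D ⟩
      A ↓ p * ((R ∸ p) * D)
    ≡⟨ cong (λ r → A ↓ p * ((R ∸ p) * r ↓ q)) (trans (pred-∸ R p) (sym (pred[m∸n]≡m∸[1+n] R p))) ⟩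
      completions p (suc q) U ∎
    where
    open ≡-Reasoning
    A = freeGood U
    B = freeBad U
    R = free U
    D = (pred R ∸ p) ↓ q
    F : Fin n → ℕ
    F i = completions p q (insert U i)
    regroup : ∀ a x b y d → a * (x * d) + b * (y * d) ≡ (a * x + b * y) * d
    regroup = solve-∀

  place : ∀ b p q U → sumF (λ i → if not (U i) ∧ allowed b i then completions p q (insert U i) else 0)
                      ≡ completions (addB b p) (addB (not b) q) U
  place true = place-marked
  place false = place-unmarked

  count-admissible : ∀ k (t : Fin k → Bool) U →
                     cnt (admissible t U) (allVecs n k) ≡ completions (cntF t) (cntF (not ∘ t)) U
  count-admissible zero t U = refl
  count-admissible (suc k) t U = begin
      cnt (admissible t U) (allVecs n (suc k))
    ≡⟨ cnt-concatMap (admissible t U) (λ i → map (i ∷ᵥ_) (allVecs n k)) id ⟩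
      sumF (λ i → cnt (admissible t U) (map (i ∷ᵥ_) (allVecs n k)))
    ≡⟨ sumF-cong first-entry ⟩
      sumF (λ i → if not (U i) ∧ allowed (t zero) i then completions p q (insert U i) else 0)
    ≡⟨ place (t zero) p q U ⟩
      completions (cntF t) (cntF (not ∘ t)) U ∎
    where
    open ≡-Reasoning
    p = cntF (t ∘ suc)
    q = cntF (not ∘ t ∘ suc)
    first-entry : ∀ i → cnt (admissible t U) (map (i ∷ᵥ_) (allVecs n k))
                        ≡ (if not (U i) ∧ allowed (t zero) i then completions p q (insert U i) else 0)
    first-entry i = begin
        cnt (admissible t U) (map (i ∷ᵥ_) (allVecs n k))
      ≡⟨ cnt-map (admissible t U) (i ∷ᵥ_) (allVecs n k) ⟩
        cnt (λ v → (not (U i) ∧ allowed (t zero) i) ∧ admissible (t ∘ suc) (insert U i) v) (allVecs n k)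
      ≡⟨ cnt-guard _ (admissible (t ∘ suc) (insert U i)) (allVecs n k) ⟩
        (if not (U i) ∧ allowed (t zero) i then cnt (admissible (t ∘ suc) (insert U i)) (allVecs n k) else 0)
      ≡⟨ cong (λ z → if not (U i) ∧ allowed (t zero) i then z else 0) (count-admissible k (t ∘ suc) (insert U i)) ⟩
        (if not (U i) ∧ allowed (t zero) i then completions p q (insert U i) else 0) ∎

  Admissible : ∀ {k} → (Fin k → Bool) → (Fin n → Bool) → Vec (Fin n) k → Set
  Admissible t U v = (∀ j → U (lookup v j) ≡ false) × Injective (lookup v) × (∀ j → t j ≡ true → good (lookup v j) ≡ true)

  admissible-sound : ∀ {k} (t : Fin k → Bool) U v → admissible t U v ≡ true → Admissible t U v
  admissible-sound t U []ᵥ _ = (λ ()) , (λ ()) , (λ ())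
  admissible-sound t U (i ∷ᵥ v) e
    with (head-ok , rest-ok) ← ∧-true {not (U i) ∧ allowed (t zero) i} e
    with (i-unused , i-allowed) ← ∧-true {not (U i)} head-ok
    with (avoid , inj , marked) ← admissible-sound (t ∘ suc) (insert U i) v rest-ok = avoid′ , inj′ , marked′
    where
    distinct : ∀ j → lookup v j ≢ i
    distinct j q with () ← trans (sym (proj₂ (∨-false {U (lookup v j)} (avoid j)))) (dec-true (lookup v j F.≟ i) q)
    avoid′ : ∀ j → U (lookup (i ∷ᵥ v) j) ≡ false
    avoid′ zero = not-true i-unused
    avoid′ (suc j) = proj₁ (∨-false (avoid j))
    inj′ : Injective (lookup (i ∷ᵥ v))
    inj′ zero zero _ = refl
    inj′ zero (suc c) q = ⊥-elim (distinct c (sym q))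
    inj′ (suc a) zero q = ⊥-elim (distinct a q)
    inj′ (suc a) (suc c) q = cong suc (inj a c q)
    marked′ : ∀ j → t j ≡ true → good (lookup (i ∷ᵥ v) j) ≡ true
    marked′ zero tj = subst (λ b → allowed b i ≡ true) tj i-allowed
    marked′ (suc j) = marked j

  admissible-complete : ∀ {k} (t : Fin k → Bool) U v → Admissible t U v → admissible t U v ≡ true
  admissible-complete t U []ᵥ _ = refl
  admissible-complete t U (i ∷ᵥ v) (avoid , inj , marked) =
    cong₂ _∧_ (cong₂ _∧_ (cong not (avoid zero)) i-allowed)
      (admissible-complete (t ∘ suc) (insert U i) v
        ( (λ j → cong₂ _∨_ (avoid (suc j)) (dec-false (lookup v j F.≟ i) (λ q → zero≢suc (inj zero (suc j) (sym q)))))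
        , (λ a c q → fsuc-injective (inj (suc a) (suc c) q))
        , marked ∘ suc ))
    where
    i-allowed : allowed (t zero) i ≡ true
    i-allowed with t zero in tz
    ... | true = marked zero tz
    ... | false = refl

-- The injectivity test by which Defs enumerates S_n.
injective? : ∀ {n} (f : Fin n → Fin n) → Dec (Injective f)
injective? f = all? (λ a → all? (λ b → (f a F.≟ f b) →-dec (a F.≟ b)))

cnt-Sym : ∀ n (P : (Fin n → Fin n) → Bool) →
          cnt P (Sym n) ≡ cnt (λ v → does (injective? (lookup v)) ∧ P (lookup v)) (allVecs n n)
cnt-Sym n P = trans (cnt-filter injective? P (allMaps n)) (cnt-map _ lookup (allVecs n n))

hamming-cntF : ∀ {n} (σ τ : Fin n → Fin n) → hamming σ τ ≡ cntF (λ a → not (eqF (σ a) (τ a)))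
hamming-cntF {n} σ τ = trans (length-filter (λ a → ¬? (σ a F.≟ τ a)) (allFin n)) (cnt-tabulate (λ a → not (eqF (σ a) (τ a))) id)

hamming-maximal : ∀ {n} (σ τ : Fin n → Fin n) → hamming σ τ ≡ n → ∀ a → σ a ≢ τ a
hamming-maximal σ τ h a q
  with () ← trans (sym (cntF-all _ (trans (sym (hamming-cntF σ τ)) h) a)) (cong not (dec-true (σ a F.≟ τ a) q))

hamming-maximal⁻¹ : ∀ {n} (σ τ : Fin n → Fin n) → (∀ a → σ a ≢ τ a) → hamming σ τ ≡ n
hamming-maximal⁻¹ σ τ differ =
  trans (hamming-cntF σ τ) (cntF-true _ (λ a → cong not (dec-false (σ a F.≟ τ a) (differ a))))

module NowhereCommuting {n : ℕ} (β : Permutation′ n) where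

  b : Fin n → Fin n
  b x = β ⟨$⟩ʳ x

  fixed moved : Fin n → Bool
  fixed x = eqF (b x) x
  moved x = not (fixed x)

  fixedPoints-cntF : fixedPoints β ≡ cntF fixed
  fixedPoints-cntF = trans (length-filter (λ a → b a F.≟ a) (allFin n)) (cnt-tabulate fixed id)

  b-injective : Injective b
  b-injective x y e = trans (sym (inverseˡ β)) (trans (cong (β ⟨$⟩ˡ_) e) (inverseˡ β))

  moved-if : ∀ {y} → b y ≢ y → moved y ≡ true
  moved-if ne = cong not (dec-false (_ F.≟ _) ne)

  moved-only-if : ∀ {y} → moved y ≡ true → b y ≢ y
  moved-only-if {y} my q with () ← trans (sym (not-true my)) (dec-true (b y F.≟ y) q)

  Nowhere : (Fin n → Fin n) → Set
  Nowhere α = ∀ a → α (b a) ≢ b (α a)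

  -- At a fixed point a we have αβ(a) = α(a), so βα(a) ≠ α(a): α maps Fix into Mov.
  nowhere⇒fixed↦moved : ∀ α → Nowhere α → ∀ j → fixed j ≡ true → moved (α j) ≡ true
  nowhere⇒fixed↦moved α nowhere j fj = moved-if (λ q → nowhere j (trans (cong α (does-true (b j F.≟ j) fj)) (sym q)))

  -- Conversely, if |Mov| ≤ |Fix| + 1, an injective α mapping Fix into Mov commutes with β
  -- nowhere: a commuting moved point a would let α map Fix ∪ {a, βa} injectively into Mov.
  fixed↦moved⇒nowhere : cntF moved ≤ suc (cntF fixed) → ∀ α → Injective α →
                        (∀ j → fixed j ≡ true → moved (α j) ≡ true) → Nowhere α
  fixed↦moved⇒nowhere bound α inj into a commutes with b a F.≟ a
  ... | yes ba≡a = moved-only-if (into a (dec-true (b a F.≟ a) ba≡a)) (trans (sym commutes) (cong α ba≡a))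
  ... | no ba≢a = <-irrefl refl (subst (_≤ suc (cntF fixed)) |S| (≤-trans S↦Mov bound))
    where
    αa-moved : b (α a) ≢ α a
    αa-moved q = ba≢a (inj _ _ (trans commutes q))
    αba-moved : b (α (b a)) ≢ α (b a)
    αba-moved q = αa-moved (b-injective _ _ (trans (sym (cong b commutes)) (trans q commutes)))
    S : Fin n → Bool
    S x = (fixed x ∨ eqF x a) ∨ eqF x (b a)
    |S| : cntF S ≡ suc (suc (cntF fixed))
    |S| = trans (cntF-insert (λ x → fixed x ∨ eqF x a) (b a)
                  (cong₂ _∨_ (dec-false (_ F.≟ _) (λ q → ba≢a (b-injective _ _ q))) (dec-false (b a F.≟ a) ba≢a)))
                (cong suc (cntF-insert fixed a (dec-false (b a F.≟ a) ba≢a)))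
    S↦moved : ∀ x → S x ≡ true → moved (α x) ≡ true
    S↦moved x Sx with ∨-true {fixed x ∨ eqF x a} Sx
    ... | inj₂ x≡ba = subst (λ z → moved (α z) ≡ true) (sym (does-true (x F.≟ b a) x≡ba)) (moved-if αba-moved)
    ... | inj₁ Sx′ with ∨-true {fixed x} Sx′
    ... | inj₁ fx = into x fx
    ... | inj₂ x≡a = subst (λ z → moved (α z) ≡ true) (sym (does-true (x F.≟ a) x≡a)) (moved-if αa-moved)
    S↦Mov : cntF S ≤ cntF moved
    S↦Mov = ≤-trans (cntF-mono {h = S} {g = moved ∘ α} S↦moved) (cntF-injective α inj moved)

  open ConstrainedInjections moved

  nowhere-admissible : cntF moved ≤ suc (cntF fixed) → ∀ v →
                       (does (injective? (lookup v)) ∧ does (hamming (lookup v ∘ b) (b ∘ lookup v) ≟ n))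
                       ≡ admissible fixed (λ _ → false) v
  nowhere-admissible bound v = bool-ext to from
    where
    α = lookup v
    to : _ → admissible fixed (λ _ → false) v ≡ true
    to e with (inj? , ham?) ← ∧-true {does (injective? α)} e =
      admissible-complete fixed (λ _ → false) v
        ( (λ _ → refl) , does-true (injective? α) inj?
        , nowhere⇒fixed↦moved α (hamming-maximal (α ∘ b) (b ∘ α) (does-true (_ ≟ n) ham?)) )
    from : admissible fixed (λ _ → false) v ≡ true → _
    from e with (_ , inj , into) ← admissible-sound fixed (λ _ → false) v e =
      cong₂ _∧_ (dec-true (injective? α) inj)
                (dec-true (_ ≟ n) (hamming-maximal⁻¹ (α ∘ b) (b ∘ α) (fixed↦moved⇒nowhere bound α inj into)))

  c-nowhere : cntF moved ≤ suc (cntF fixed) → c n β ≡ cntF moved ↓ cntF fixed * cntF moved !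
  c-nowhere bound = begin
      c n β
    ≡⟨ length-filter (λ α → hamming (α ∘ b) (b ∘ α) ≟ n) (Sym n) ⟩
      cnt (λ α → does (hamming (α ∘ b) (b ∘ α) ≟ n)) (Sym n)
    ≡⟨ cnt-Sym n (λ α → does (hamming (α ∘ b) (b ∘ α) ≟ n)) ⟩
      cnt (λ v → does (injective? (lookup v)) ∧ does (hamming (lookup v ∘ b) (b ∘ lookup v) ≟ n)) (allVecs n n)
    ≡⟨ cnt-cong (nowhere-admissible bound) (allVecs n n) ⟩
      cnt (admissible fixed (λ _ → false)) (allVecs n n)
    ≡⟨ count-admissible n fixed (λ _ → false) ⟩
      cntF moved ↓ cntF fixed * (cntF {n} (λ _ → true) ∸ cntF fixed) ↓ cntF moved
    ≡⟨ cong (λ r → cntF moved ↓ cntF fixed * r ↓ cntF moved) |Mov| ⟩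
      cntF moved ↓ cntF fixed * cntF moved ↓ cntF moved
    ≡⟨ cong (cntF moved ↓ cntF fixed *_) (↓-self (cntF moved)) ⟩
      cntF moved ↓ cntF fixed * cntF moved ! ∎
    where
    open ≡-Reasoning
    |Mov| : cntF {n} (λ _ → true) ∸ cntF fixed ≡ cntF moved
    |Mov| = begin
        cntF {n} (λ _ → true) ∸ cntF fixed        ≡⟨ cong (_∸ cntF fixed) (cntF-true _ (λ _ → refl)) ⟩
        n ∸ cntF fixed                        ≡⟨ cong (_∸ cntF fixed) (sym (cntF-compl fixed)) ⟩
        cntF fixed + cntF moved ∸ cntF fixed  ≡⟨ m+n∸m≡n (cntF fixed) (cntF moved) ⟩
        cntF moved                            ∎

-- With m = m' + 1: n = 2m - 1 = m' + m, |Fix| = m' and hence |Mov| = m, so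
-- c(n, β) = m ↓ (m - 1) · m! = m! · m!.
proposition3p7 : (m : ℕ) → 1 ≤ m → (β : Permutation′ (2 * m ∸ 1)) →
                   fixedPoints β ≡ m ∸ 1 →
                   c (2 * m ∸ 1) β ≡ (m !) ^ 2
proposition3p7 (suc m') _ β |Fix|≡m' = begin
    c n β                                 ≡⟨ c-nowhere (≤-reflexive (trans |Mov| (cong suc (sym |Fix|)))) ⟩
    cntF moved ↓ cntF fixed * cntF moved ! ≡⟨ cong₂ (λ f g → g ↓ f * g !) |Fix| |Mov| ⟩
    suc m' ↓ m' * suc m' !                ≡⟨ cong (_* suc m' !) (↓-pred-self m') ⟩
    suc m' ! * suc m' !                   ≡⟨ cong (suc m' ! *_) (sym (*-identityʳ (suc m' !))) ⟩
    (suc m' !) ^ 2                        ∎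
  where
  open ≡-Reasoning
  n = 2 * suc m' ∸ 1
  open NowhereCommuting β
  n≡m'+m : n ≡ m' + suc m'
  n≡m'+m = cong (λ k → m' + suc k) (+-identityʳ m')
  |Fix| : cntF fixed ≡ m'
  |Fix| = trans (sym fixedPoints-cntF) |Fix|≡m'
  |Mov| : cntF moved ≡ suc m'
  |Mov| = +-cancelˡ-≡ m' _ _ (trans (cong (_+ cntF moved) (sym |Fix|)) (trans (cntF-compl fixed) n≡m'+m))
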